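{- For all integers $s \ge 0$ and $t\ge 0$, a linear extension of $EN_{s,t}$ avoids $1243$ if and only if it is a linear extension of $SAW_{s,t}$; equivalently, a linear extension of $EN_{s,t}$ avoids $1243$ if and only if, for every $j$ with $1\le j\le s-1$, the entry $(j+1)t$ appears before the entry $(j-1)t+2$.
   Context: For nonnegative integers $s,t$ (the poset being empty when $st=0$), write each $x \in [st]=\{1,\dots,st\}$ uniquely as $x=(j-1)t+r$ with $1\le j\le s$ and $1\le r\le t$. The poset $EN_{s,t}$ is $[st]$ with the partial order $(j-1)t+r \preceq (j'-1)t+r'$ if and only if $j'\le j$ and $r\le r'$. The sawblade poset $SAW_{s,t}$ is the poset on $[st]$ whose order is generated (by transitive closure) by the relations of $EN_{s,t}$ together with the relations $(j+1)t \preceq (j-1)t+2$ for all $1\le j\le s-1$ (i.e. $(j-1)t+2$ covers $(j+1)t$). A linear extension of a poset $([n],\preceq)$ is a permutation $\pi=\pi(1)\cdots\pi(n)$ of $[n]$ (one-line notation) such that whenever $a\preceq b$ and $a\ne b$, $a$ appears before $b$ in $\pi$. A permutation $\pi$ avoids $\sigma$ if $\pi$ has no subsequence with the same relative order as $\sigma$. -}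

module Defs where

open import Data.Nat using (ℕ; zero; suc; _+_; _*_; _∸_; _≤_; _<_)
open import Data.Fin using (Fin; toℕ)
open import Data.List using (List; length; lookup; map; upTo)
open import Data.Product using (Σ; ∃; ∃-syntax; _×_; _,_)
open import Data.Sum using (_⊎_)
open import Relation.Nullary using (¬_)
open import Relation.Binary.PropositionalEquality using (_≡_; _≢_)
open import Data.List.Relation.Binary.Permutation.Propositional using (_↭_)
open import Relation.Binary.Construct.Closure.Transitive using (TransClosure)

range : ℕ → List ℕ
range n = map suc (upTo n)

IsPerm : ℕ → List ℕ → Set
IsPerm n π = π ↭ range n

Before : List ℕ → ℕ → ℕ → Set
Before π a b = ∃[ i ] ∃[ k ] (toℕ {length π} i < toℕ k × lookup π i ≡ a × lookup π k ≡ b)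

Avoids1243 : List ℕ → Set
Avoids1243 π = ¬ (∃[ i₁ ] ∃[ i₂ ] ∃[ i₃ ] ∃[ i₄ ]
  ( toℕ {length π} i₁ < toℕ i₂ × toℕ i₂ < toℕ i₃ × toℕ i₃ < toℕ i₄
  × lookup π i₁ < lookup π i₂ × lookup π i₂ < lookup π i₄
  × lookup π i₄ < lookup π i₃))

LinExt : (ℕ → ℕ → Set) → ℕ → List ℕ → Set
LinExt _⪯_ n π = IsPerm n π ×
  (∀ a b → 1 ≤ a → a ≤ n → 1 ≤ b → b ≤ n → a ⪯ b → a ≢ b → Before π a b)

EN : ℕ → ℕ → ℕ → ℕ → Set
EN s t x y = ∃[ j ] ∃[ r ] ∃[ j' ] ∃[ r' ]
  ( (1 ≤ j × j ≤ s) × (1 ≤ r × r ≤ t) × (1 ≤ j' × j' ≤ s) × (1 ≤ r' × r' ≤ t)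
  × x ≡ (j ∸ 1) * t + r × y ≡ (j' ∸ 1) * t + r'
  × j' ≤ j × r ≤ r')

SAWgen : ℕ → ℕ → ℕ → ℕ → Set
SAWgen s t x y = EN s t x y ⊎
  (∃[ j ] (1 ≤ j × j + 1 ≤ s × x ≡ (j + 1) * t × y ≡ (j ∸ 1) * t + 2))

SAW : ℕ → ℕ → ℕ → ℕ → Set
SAW s t = TransClosure (SAWgen s t)

-- Write x ∈ [st] as q t + r with 0 ≤ q < s, 1 ≤ r ≤ t: the cell (q, r) of an s × t grid, on which
-- EN_{s,t} reads (q, r) ⪯ (q′, r′) iff q′ ≤ q and r ≤ r′.  In a linear extension, a 1243 pattern
-- a b c d forces col a < col b (else b ⪯ a) and row d < row c (else d ⪯ c); as row b ≤ row d,
-- the cell X = (row b + 1, t) satisfies c ⪯ X, while the sawblade relation X ⪯ (row b, 2) ⪯ b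
-- would put X before b before c before X.  Conversely, if (q, 2) preceded X = (q + 1, t) with
-- t ≥ 3, then (q, 1) (q, 2) X (q, t) would be a 1243 pattern; for t = 2 already X ⪯ (q, 2) in EN.
module Submission where

open import Defs
open import Relation.Binary.PropositionalEquality
open import Data.Nat using (ℕ; zero; suc; _+_; _*_; _∸_; _≤_; _<_; z≤n; s≤s)
open import Data.Nat.Properties
open import Data.Nat.DivMod using (_/_; _%_; m≡m%n+[m/n]*n; m%n<n; m<n*o⇒m/o<n)
open import Data.Fin using (Fin; toℕ; zero; suc)
open import Data.Fin.Properties using (toℕ-injective)
open import Data.List using (List; _∷_; length; lookup)
import Data.List.Relation.Unary.All as All
open import Data.List.Relation.Unary.Any using (index)
open import Data.List.Relation.Unary.Any.Properties using (lookup-index)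
open import Data.List.Relation.Unary.Unique.Propositional using (Unique; _∷_)
import Data.List.Relation.Unary.Unique.Propositional.Properties as Unique
open import Data.List.Membership.Propositional using (_∈_)
open import Data.List.Membership.Propositional.Properties
  using (∈-map⁺; ∈-map⁻; ∈-upTo⁺; ∈-upTo⁻; ∈-lookup)
open import Data.List.Relation.Binary.Permutation.Propositional using (↭-sym; ↭⇒↭ₛ)
open import Data.List.Relation.Binary.Permutation.Propositional.Properties using (∈-resp-↭)
open import Data.List.Relation.Binary.Permutation.Setoid.Properties (setoid ℕ)
  using (Unique-resp-↭)
open import Data.Product using (Σ-syntax; _×_; _,_; proj₁; proj₂; uncurry)
open import Data.Sum using (_⊎_; inj₁; inj₂; fromInj₁)
open import Function.Base using (_∘_)
open import Data.Empty using (⊥; ⊥-elim)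
open import Relation.Nullary using (¬_; yes; no)
open import Relation.Binary.Construct.Closure.Transitive using ([_]; _∷_)
open import Relation.Binary.Construct.Closure.Reflexive using (ReflClosure; refl; [_]; reflexive)
import Relation.Binary.Construct.Closure.Reflexive.Properties as ReflClosure
open import Relation.Binary.Definitions using (tri<; tri≈; tri>)
open import Function.Bundles using (_⇔_; mk⇔; Equivalence)

lookup-injective : ∀ {xs : List ℕ} → Unique xs → ∀ i k → lookup xs i ≡ lookup xs k → i ≡ k
lookup-injective (_ ∷ _) zero zero _ = refl
lookup-injective (x∉xs ∷ _) zero (suc k) eq = ⊥-elim (All.lookup x∉xs (∈-lookup k) eq)
lookup-injective (x∉xs ∷ _) (suc i) zero eq = ⊥-elim (All.lookup x∉xs (∈-lookup i) (sym eq))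
lookup-injective (_ ∷ u) (suc i) (suc k) eq = cong suc (lookup-injective u i k eq)

range-unique : ∀ n → Unique (range n)
range-unique n = Unique.map⁺ suc-injective (Unique.upTo⁺ n)

∈-range⁻ : ∀ {n x} → x ∈ range n → 1 ≤ x × x ≤ n
∈-range⁻ x∈ with ∈-map⁻ suc x∈
... | _ , y∈ , refl = s≤s z≤n , ∈-upTo⁻ y∈

∈-range⁺ : ∀ {n x} → 1 ≤ x → x ≤ n → x ∈ range n
∈-range⁺ {x = suc _} _ x≤n = ∈-map⁺ suc (∈-upTo⁺ x≤n)

module Positions {n : ℕ} {π : List ℕ} (π↭ : IsPerm n π) where

  unique : Unique π
  unique = Unique-resp-↭ (↭⇒↭ₛ (↭-sym π↭)) (range-unique n)

  lookup-∈-range : ∀ i → 1 ≤ lookup π i × lookup π i ≤ n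
  lookup-∈-range i = ∈-range⁻ (∈-resp-↭ π↭ (∈-lookup i))

  position : ∀ {x} → 1 ≤ x → x ≤ n → Σ[ i ∈ Fin (length π) ] lookup π i ≡ x
  position 1≤x x≤n = index x∈π , sym (lookup-index x∈π)
    where x∈π = ∈-resp-↭ (↭-sym π↭) (∈-range⁺ 1≤x x≤n)

  Before⇒<-positions : ∀ {x y i k} → Before π x y →
                       lookup π i ≡ x → lookup π k ≡ y → toℕ i < toℕ k
  Before⇒<-positions (i′ , k′ , i′<k′ , refl , refl) πi≡x πk≡y
    rewrite lookup-injective unique i′ _ (sym πi≡x) | lookup-injective unique k′ _ (sym πk≡y)
    = i′<k′

  Before-trans : ∀ {x y z} → Before π x y → Before π y z → Before π x z
  Before-trans (i , j , i<j , πi , πj) y<z@(_ , k , _ , _ , πk) =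
    i , k , <-trans i<j (Before⇒<-positions y<z πj πk) , πi , πk

  Before-irrefl : ∀ {x} → ¬ Before π x x
  Before-irrefl x<x@(i , _ , _ , πi , _) = <-irrefl refl (Before⇒<-positions x<x πi πi)

  Before-total : ∀ {x y} → 1 ≤ x → x ≤ n → 1 ≤ y → y ≤ n → x ≢ y → Before π x y ⊎ Before π y x
  Before-total 1≤x x≤n 1≤y y≤n x≢y
    with position 1≤x x≤n | position 1≤y y≤n
  ... | i , πi | k , πk with <-cmp (toℕ i) (toℕ k)
  ...   | tri< i<k _ _ = inj₁ (i , k , i<k , πi , πk)
  ...   | tri> _ _ k<i = inj₂ (k , i , k<i , πk , πi)
  ...   | tri≈ _ i≡k _ = ⊥-elim (x≢y (trans (sym πi) (trans (cong (lookup π) (toℕ-injective i≡k)) πk)))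

  _≼_ : ℕ → ℕ → Set
  _≼_ = ReflClosure (Before π)

  ≼-trans : ∀ {x y z} → x ≼ y → y ≼ z → x ≼ z
  ≼-trans = ReflClosure.trans Before-trans

  ≼-Before-trans : ∀ {x y z} → x ≼ y → Before π y z → Before π x z
  ≼-Before-trans refl y<z = y<z
  ≼-Before-trans [ x<y ] y<z = Before-trans x<y y<z

  Before-≼-trans : ∀ {x y z} → Before π x y → y ≼ z → Before π x z
  Before-≼-trans x<y refl = x<y
  Before-≼-trans x<y [ y<z ] = Before-trans x<y y<z

  ≼∧≢⇒Before : ∀ {x y} → x ≼ y → x ≢ y → Before π x y
  ≼∧≢⇒Before refl x≢x = ⊥-elim (x≢x refl)
  ≼∧≢⇒Before [ x<y ] _ = x<y

  Before-1243⇒¬Avoids1243 : ∀ {a b c d} → Before π a b → Before π b c → Before π c d →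
                            a < b → b < d → d < c → ¬ Avoids1243 π
  Before-1243⇒¬Avoids1243 (i₁ , i₂ , i₁<i₂ , πi₁ , πi₂) b<c@(_ , i₃ , _ , _ , πi₃)
                          c<d@(_ , i₄ , _ , _ , πi₄) a<b b<d d<c avoids =
    avoids (i₁ , i₂ , i₃ , i₄ , i₁<i₂
           , Before⇒<-positions b<c πi₂ πi₃ , Before⇒<-positions c<d πi₃ πi₄
           , subst₂ _<_ (sym πi₁) (sym πi₂) a<b
           , subst₂ _<_ (sym πi₂) (sym πi₄) b<d
           , subst₂ _<_ (sym πi₄) (sym πi₃) d<c)

  Avoids1243-of-empty : n ≡ 0 → Avoids1243 π
  Avoids1243-of-empty refl (i , _) = n≮0 (uncurry ≤-trans (lookup-∈-range i))

  LinExt-of-empty : ∀ (R : ℕ → ℕ → Set) → n ≡ 0 → LinExt R n π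
  LinExt-of-empty _ refl = π↭ , λ _ _ 1≤a a≤0 → ⊥-elim (n≮0 (≤-trans 1≤a a≤0))

[m+1]*n≡m*n+n : ∀ m n → (m + 1) * n ≡ m * n + n
[m+1]*n≡m*n+n m n = trans (*-distribʳ-+ n m 1) (cong (m * n +_) (*-identityˡ n))

record Cell (s t : ℕ) : Set where
  constructor cell
  field
    row col : ℕ
    row<s : row < s
    1≤col : 1 ≤ col
    col≤t : col ≤ t

  label : ℕ
  label = row * t + col

open Cell

label-surjective : ∀ s t {v} → 1 ≤ v → v ≤ s * t → Σ[ c ∈ Cell s t ] label c ≡ v
label-surjective s zero {suc _} _ v≤s*0 = ⊥-elim (n≮0 (≤-trans v≤s*0 (≤-reflexive (*-zeroʳ s))))
label-surjective s t@(suc _) {suc v} _ v<s*t =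
  cell (v / t) (suc (v % t)) (m<n*o⇒m/o<n v<s*t) (s≤s z≤n) (m%n<n v t) , (begin
    v / t * t + suc (v % t)  ≡⟨ +-suc (v / t * t) (v % t) ⟩
    suc (v / t * t + v % t)  ≡⟨ cong suc (+-comm (v / t * t) (v % t)) ⟩
    suc (v % t + v / t * t)  ≡⟨ cong suc (m≡m%n+[m/n]*n v t) ⟨
    suc v                    ∎)
  where open ≡-Reasoning

module _ {s t : ℕ} where

  label-positive : (c : Cell s t) → 1 ≤ label c
  label-positive c = ≤-trans (1≤col c) (m≤n+m (col c) (row c * t))

  label-<-by-row : (c d : Cell s t) → row c < row d → label c < label d
  label-<-by-row c d rc<rd = begin-strict
    row c * t + col c  ≤⟨ +-monoʳ-≤ (row c * t) (col≤t c) ⟩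
    row c * t + t      ≡⟨ +-comm (row c * t) t ⟩
    suc (row c) * t    ≤⟨ *-monoˡ-≤ t rc<rd ⟩
    row d * t          <⟨ m<m+n (row d * t) (1≤col d) ⟩
    label d            ∎
    where open ≤-Reasoning

  label-≤ : (c : Cell s t) → label c ≤ s * t
  label-≤ c = begin
    row c * t + col c  ≤⟨ +-monoʳ-≤ (row c * t) (col≤t c) ⟩
    row c * t + t      ≡⟨ +-comm (row c * t) t ⟩
    suc (row c) * t    ≤⟨ *-monoˡ-≤ t (row<s c) ⟩
    s * t              ∎
    where open ≤-Reasoning

  label-<⇒row-≤ : (c d : Cell s t) → label c < label d → row c ≤ row d
  label-<⇒row-≤ c d lc<ld with row c ≤? row d
  ... | yes rc≤rd = rc≤rd
  ... | no rc≰rd = ⊥-elim (<-asym lc<ld (label-<-by-row d c (≰⇒> rc≰rd)))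

  label-<⇒col-< : (c d : Cell s t) → row c ≡ row d → label c < label d → col c < col d
  label-<⇒col-< c d rc≡rd lc<ld =
    +-cancelˡ-< (row c * t) (col c) (col d) (subst (λ r → label c < r * t + col d) (sym rc≡rd) lc<ld)

  EN-label : (c d : Cell s t) → row d ≤ row c → col c ≤ col d → EN s t (label c) (label d)
  EN-label c d rd≤rc cc≤cd =
    suc (row c) , col c , suc (row d) , col d ,
    (s≤s z≤n , row<s c) , (1≤col c , col≤t c) , (s≤s z≤n , row<s d) , (1≤col d , col≤t d) ,
    refl , refl , s≤s rd≤rc , cc≤cd

SawCovers : ℕ → ℕ → (ℕ → ℕ → Set) → Set
SawCovers s t R = ∀ j → 1 ≤ j → j + 1 ≤ s → R ((j + 1) * t) ((j ∸ 1) * t + 2)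

-- SawCovers with j = q + 1, so that both entries are cell labels.
SawCoversRows : ℕ → ℕ → (ℕ → ℕ → Set) → Set
SawCoversRows s t R = ∀ q → 2 + q ≤ s → R (suc q * t + t) (q * t + 2)

SawCovers⇔SawCoversRows : ∀ {s t} (R : ℕ → ℕ → Set) → SawCovers s t R ⇔ SawCoversRows s t R
SawCovers⇔SawCoversRows {s} {t} R = mk⇔
  (λ covers q 2+q≤s → subst (λ x → R x (q * t + 2)) ([m+1]*n≡m*n+n (suc q) t)
    (covers (suc q) (s≤s z≤n) (subst (_≤ s) (+-comm 1 (suc q)) 2+q≤s)))
  (λ { covers (suc q) _ j+1≤s → subst (λ x → R x (q * t + 2)) (sym ([m+1]*n≡m*n+n (suc q) t))
    (covers q (subst (_≤ s) (+-comm (suc q) 1) j+1≤s)) })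

SawCovers-mono : ∀ {s t} {R S : ℕ → ℕ → Set} → (∀ {x y} → R x y → S x y) →
                 SawCovers s t R → SawCovers s t S
SawCovers-mono R⇒S covers j 1≤j j+1≤s = R⇒S (covers j 1≤j j+1≤s)

SawCovers-width-one : ∀ s {R : ℕ → ℕ → Set} → SawCovers s 1 (ReflClosure R)
SawCovers-width-one s (suc q) _ _ = reflexive (begin
  (suc q + 1) * 1  ≡⟨ *-identityʳ (suc q + 1) ⟩
  suc q + 1        ≡⟨ +-suc q 1 ⟨
  q + 2            ≡⟨ cong (_+ 2) (*-identityʳ q) ⟨
  q * 1 + 2        ∎)
  where open ≡-Reasoning

SAW-sawblade : ∀ {s t} → SawCoversRows s t (SAW s t)
SAW-sawblade = Equivalence.to (SawCovers⇔SawCoversRows (SAW _ _))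
  λ j 1≤j j+1≤s → [ inj₂ (j , 1≤j , j+1≤s , refl , refl) ]

module Extension (s t : ℕ) (π : List ℕ) (ext : LinExt (EN s t) (s * t) π) where

  open Positions (proj₁ ext) public

  EN-≼ : (c d : Cell s t) → row d ≤ row c → col c ≤ col d → label c ≼ label d
  EN-≼ c d rd≤rc cc≤cd with label c ≟ label d
  ... | yes lc≡ld = reflexive lc≡ld
  ... | no lc≢ld = [ proj₂ ext _ _ (label-positive c) (label-≤ c) (label-positive d) (label-≤ d)
                       (EN-label c d rd≤rc cc≤cd) lc≢ld ]

  ascent⇒col-< : (a b : Cell s t) → label a < label b → Before π (label a) (label b) → col a < col b
  ascent⇒col-< a b la<lb a≺b with col a <? col b
  ... | yes ca<cb = ca<cb
  ... | no ca≮cb = ⊥-elim (Before-irrefl (Before-≼-trans a≺b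
                     (EN-≼ b a (label-<⇒row-≤ a b la<lb) (≮⇒≥ ca≮cb))))

  descent⇒row-< : (c d : Cell s t) → label d < label c → Before π (label c) (label d) → row d < row c
  descent⇒row-< c d ld<lc c≺d with m≤n⇒m<n∨m≡n (label-<⇒row-≤ d c ld<lc)
  ... | inj₁ rd<rc = rd<rc
  ... | inj₂ rd≡rc = ⊥-elim (Before-irrefl (Before-≼-trans c≺d
                       (EN-≼ d c (≤-reflexive (sym rd≡rc)) (<⇒≤ (label-<⇒col-< d c rd≡rc ld<lc)))))

  SawCovers≼⇒no-1243 : SawCovers s t _≼_ → (a b c d : Cell s t) →
    label a < label b → label b < label d → label d < label c →
    Before π (label a) (label b) → Before π (label b) (label c) → Before π (label c) (label d) → ⊥
  SawCovers≼⇒no-1243 covers a b c d la<lb lb<ld ld<lc a≺b b≺c c≺d =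
    Before-irrefl (≼-Before-trans X≼b (Before-≼-trans b≺c c≼X))
    where
      rb<rc : row b < row c
      rb<rc = ≤-<-trans (label-<⇒row-≤ b d lb<ld) (descent⇒row-< c d ld<lc c≺d)
      2+rb≤s : 2 + row b ≤ s
      2+rb≤s = ≤-<-trans rb<rc (row<s c)
      2≤cb : 2 ≤ col b
      2≤cb = ≤-trans (s≤s (1≤col a)) (ascent⇒col-< a b la<lb a≺b)
      X Y : Cell s t
      X = cell (suc (row b)) t 2+rb≤s (≤-trans (1≤col b) (col≤t b)) ≤-refl
      Y = cell (row b) 2 (row<s b) (s≤s z≤n) (≤-trans 2≤cb (col≤t b))
      c≼X : label c ≼ label X
      c≼X = EN-≼ c X rb<rc (col≤t c)
      X≼b : label X ≼ label b
      X≼b = ≼-trans (Equivalence.to (SawCovers⇔SawCoversRows _≼_) covers (row b) 2+rb≤s)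
                    (EN-≼ Y b ≤-refl 2≤cb)

  cell-at : ∀ i → Σ[ c ∈ Cell s t ] lookup π i ≡ label c
  cell-at i with label-surjective s t (proj₁ (lookup-∈-range i)) (proj₂ (lookup-∈-range i))
  ... | c , lc≡πi = c , sym lc≡πi

  SawCovers≼⇒Avoids1243 : SawCovers s t _≼_ → Avoids1243 π
  SawCovers≼⇒Avoids1243 covers (i₁ , i₂ , i₃ , i₄ , i₁<i₂ , i₂<i₃ , i₃<i₄ , π₁<π₂ , π₂<π₄ , π₄<π₃)
    with cell-at i₁ | cell-at i₂ | cell-at i₃ | cell-at i₄
  ... | a , π₁≡a | b , π₂≡b | c , π₃≡c | d , π₄≡d =
    SawCovers≼⇒no-1243 covers a b c d
      (subst₂ _<_ π₁≡a π₂≡b π₁<π₂) (subst₂ _<_ π₂≡b π₄≡d π₂<π₄) (subst₂ _<_ π₄≡d π₃≡c π₄<π₃)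
      (i₁ , i₂ , i₁<i₂ , π₁≡a , π₂≡b) (i₂ , i₃ , i₂<i₃ , π₂≡b , π₃≡c) (i₃ , i₄ , i₃<i₄ , π₃≡c , π₄≡d)

  module _ (2≤t : 2 ≤ t) (q : ℕ) (2+q≤s : 2 + q ≤ s) where

    private
      1≤t : 1 ≤ t
      1≤t = ≤-trans (s≤s z≤n) 2≤t

      q<s : q < s
      q<s = ≤-trans (n≤1+n (suc q)) 2+q≤s

    corner notch : Cell s t
    corner = cell (suc q) t 2+q≤s 1≤t ≤-refl
    notch = cell q 2 q<s (s≤s z≤n) 2≤t

    notch<corner : label notch < label corner
    notch<corner = label-<-by-row notch corner ≤-refl

    Avoids1243⇒corner≺notch : Avoids1243 π → Before π (label corner) (label notch)
    Avoids1243⇒corner≺notch avoids =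
      fromInj₁ (⊥-elim ∘ ¬notch≺corner)
        (Before-total (label-positive corner) (label-≤ corner) (label-positive notch) (label-≤ notch)
                      (>⇒≢ notch<corner))
      where
        ¬notch≺corner : ¬ Before π (label notch) (label corner)
        ¬notch≺corner n≺c with m≤n⇒m<n∨m≡n 2≤t
        ... | inj₂ 2≡t = Before-irrefl (Before-≼-trans n≺c
                           (EN-≼ corner notch (n≤1+n q) (≤-reflexive (sym 2≡t))))
        ... | inj₁ 2<t = Before-1243⇒¬Avoids1243 first≺n n≺c c≺last first<n n<last last<c avoids
          where
            first last : Cell s t
            first = cell q 1 q<s ≤-refl 1≤t
            last = cell q t q<s 1≤t ≤-refl
            first<n : label first < label notch
            first<n = +-monoʳ-< (q * t) ≤-refl
            n<last : label notch < label last
            n<last = +-monoʳ-< (q * t) 2<t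
            last<c : label last < label corner
            last<c = label-<-by-row last corner ≤-refl
            first≺n : Before π (label first) (label notch)
            first≺n = ≼∧≢⇒Before (EN-≼ first notch ≤-refl (s≤s z≤n)) (<⇒≢ first<n)
            c≺last : Before π (label corner) (label last)
            c≺last = ≼∧≢⇒Before (EN-≼ corner last (n≤1+n q) ≤-refl) (>⇒≢ last<c)

    SAW-LinExt⇒corner≺notch : LinExt (SAW s t) (s * t) π → Before π (label corner) (label notch)
    SAW-LinExt⇒corner≺notch (_ , SAW⇒Before) =
      SAW⇒Before _ _ (label-positive corner) (label-≤ corner) (label-positive notch) (label-≤ notch)
                 (SAW-sawblade q 2+q≤s) (>⇒≢ notch<corner)

  SAWgen⇒≼ : SawCovers s t _≼_ → ∀ {x y} → SAWgen s t x y → x ≼ y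
  SAWgen⇒≼ _ (inj₁ (suc q , r , suc q′ , r′ , (_ , q<s) , (1≤r , r≤t) , (_ , q′<s) , (1≤r′ , r′≤t) ,
                    refl , refl , s≤s q′≤q , r≤r′)) =
    EN-≼ (cell q r q<s 1≤r r≤t) (cell q′ r′ q′<s 1≤r′ r′≤t) q′≤q r≤r′
  SAWgen⇒≼ covers (inj₂ (j , 1≤j , j+1≤s , refl , refl)) = covers j 1≤j j+1≤s

  SAW⇒≼ : SawCovers s t _≼_ → ∀ {x y} → SAW s t x y → x ≼ y
  SAW⇒≼ covers [ x⋖y ] = SAWgen⇒≼ covers x⋖y
  SAW⇒≼ covers (x⋖y ∷ y<z) = ≼-trans (SAWgen⇒≼ covers x⋖y) (SAW⇒≼ covers y<z)

  SawCovers≼⇒SAW-LinExt : SawCovers s t _≼_ → LinExt (SAW s t) (s * t) π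
  SawCovers≼⇒SAW-LinExt covers =
    proj₁ ext , λ _ _ _ _ _ _ x<y x≢y → ≼∧≢⇒Before (SAW⇒≼ covers x<y) x≢y

  SawCovers≼-of-strict : 1 ≤ t → (2 ≤ t → SawCovers s t (Before π)) → SawCovers s t _≼_
  SawCovers≼-of-strict 1≤t strict with m≤n⇒m<n∨m≡n 1≤t
  ... | inj₁ 2≤t = SawCovers-mono {S = _≼_} [_] (strict 2≤t)
  ... | inj₂ 1≡t = subst (λ t → SawCovers s t _≼_) 1≡t (SawCovers-width-one s)

  Avoids1243⇒SawCovers : 2 ≤ t → Avoids1243 π → SawCovers s t (Before π)
  Avoids1243⇒SawCovers 2≤t avoids = Equivalence.from (SawCovers⇔SawCoversRows (Before π))
    λ q 2+q≤s → Avoids1243⇒corner≺notch 2≤t q 2+q≤s avoids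

  SAW-LinExt⇒SawCovers : 2 ≤ t → LinExt (SAW s t) (s * t) π → SawCovers s t (Before π)
  SAW-LinExt⇒SawCovers 2≤t saw = Equivalence.from (SawCovers⇔SawCoversRows (Before π))
    λ q 2+q≤s → SAW-LinExt⇒corner≺notch 2≤t q 2+q≤s saw

theorem4p2 : (s t : ℕ) → (π : List ℕ) → LinExt (EN s t) (s * t) π →
    (Avoids1243 π ⇔ LinExt (SAW s t) (s * t) π)
    × (2 ≤ t → (Avoids1243 π ⇔
    (∀ j → 1 ≤ j → j + 1 ≤ s → Before π ((j + 1) * t) ((j ∸ 1) * t + 2))))
theorem4p2 s zero π (π↭ , _) =
  mk⇔ (λ _ → LinExt-of-empty (SAW s 0) (*-zeroʳ s)) (λ _ → Avoids1243-of-empty (*-zeroʳ s)) , λ ()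
  where open Positions π↭
theorem4p2 s t@(suc _) π ext =
  mk⇔ (λ avoids → SawCovers≼⇒SAW-LinExt
                     (SawCovers≼-of-strict 1≤t (λ 2≤t → Avoids1243⇒SawCovers 2≤t avoids)))
      (λ saw → SawCovers≼⇒Avoids1243
                  (SawCovers≼-of-strict 1≤t (λ 2≤t → SAW-LinExt⇒SawCovers 2≤t saw)))
  , λ 2≤t → mk⇔ (Avoids1243⇒SawCovers 2≤t) (SawCovers≼⇒Avoids1243 ∘ SawCovers-mono {S = _≼_} [_])
  where
    open Extension s t π ext
    1≤t : 1 ≤ t
    1≤t = s≤s z≤n
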